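{- Let $n\ge2$ and let $\mathscr{A}$ be a closed set of games such that $\mathcal{Q}(\mathscr{A})$ is faithful and is identified with $\mathcal{T}_n$ in such a way that every $X\in\mathscr{A}$ with $\Phi(X)=z_i$ has Grundy value $i$. Let $G\ne0$ be a game all of whose options lie in $\mathscr{A}$, and let $\mathcal{P}^+$ be the distinguished subset of $\mathcal{Q}(\mathrm{cl}(\mathscr{A}\cup\{G\}))$. If $\Phi''G$ is restless, then $|\mathcal{P}^+|\ge3$.
   Context: Impartial games: a game is the set of its options; $0=\emptyset$; $G+H$ has options $G'+H$, $G+H'$. Misère play: $G$ is a $\mathscr{P}$-position iff $G\ne0$ and every option is an $\mathscr{N}$-position. A set of games is closed if it contains $0$ and is closed under options and sums; $\mathrm{cl}(\mathscr{S})$ is the smallest closed set containing $\mathscr{S}$. For closed $\mathscr{A}$, $G\equiv_\mathscr{A}H$ iff $G+X$, $H+X$ have the same misère outcome for all $X\in\mathscr{A}$; $\mathcal{Q}(\mathscr{A})=\mathscr{A}/{\equiv_\mathscr{A}}$ with distinguished subset the classes of $\mathscr{P}$-positions, $\Phi$ the quotient map of $\mathscr{A}$; $\Phi''G=\{\Phi(G'):G'$ an option of $G\}$. $\mathscr{G}$ = Grundy value; faithful means $\Phi(X)=\Phi(Y)\Rightarrow\mathscr{G}(X)=\mathscr{G}(Y)$. $\mathcal{T}_n$ has distinct elements $1,a,z_0,\ldots,z_{2^n-1}$, identity $1$, $a^2=1$, $z_iz_j=z_{i\oplus j}$, $az_i=z_{i\oplus1}$ ($\oplus$ bitwise XOR),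 distinguished subset $\{a,z_0\}$; $z=z_0$. For $\mathcal{E}\subseteq\mathcal{T}_n$ with $\Delta=\mathcal{E}\cap\{1,a,z,az\}$, $\mathcal{E}$ is restless if $\Delta=\{a,z\}$ or $\Delta=\{1,az\}$. -}

module Defs where

open import Data.Nat using (ℕ; zero; suc; _+_; _*_)
open import Data.Bool using (Bool; true; false; not; _xor_; _∧_; if_then_else_)
open import Data.List using (List; []; _∷_; _++_)
open import Data.List.Membership.Propositional using (_∈_)
open import Data.Vec using (Vec; []; _∷_; zipWith; replicate)
open import Data.Product using (Σ; _×_; ∃)
open import Data.Sum using (_⊎_)
open import Relation.Nullary using (¬_)
open import Relation.Binary.PropositionalEquality using (_≡_)

data Game : Set where
  mk : List Game → Game

options : Game → List Game
options (mk gs) = gs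

zeroG : Game
zeroG = mk []

infixl 6 _⊕_
_⊕_ : Game → Game → Game
sumL : List Game → Game → List Game
sumR : Game → List Game → List Game
g@(mk gs) ⊕ h@(mk hs) = mk (sumL gs h ++ sumR g hs)
sumL [] h = []
sumL (g ∷ gs) h = (g ⊕ h) ∷ sumL gs h
sumR g [] = []
sumR g (h ∷ hs) = (g ⊕ h) ∷ sumR g hs

-- Misère play: G is a P-position iff G ≠ 0 and every option is an N-position.
isP : Game → Bool
allN : List Game → Bool
isP (mk []) = false
isP (mk (g ∷ gs)) = allN (g ∷ gs)
allN [] = true
allN (g ∷ gs) = not (isP g) ∧ allN gs

elemℕ : ℕ → List ℕ → Bool
elemℕ k [] = false
elemℕ k (x ∷ xs) = if Data.Nat._≡ᵇ_ k x then true else elemℕ k xs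

len : List ℕ → ℕ
len [] = 0
len (_ ∷ xs) = suc (len xs)

-- search fuel k l: least m ≥ k with m ∉ l (fuel = len l suffices)
mexSearch : ℕ → ℕ → List ℕ → ℕ
mexSearch zero k l = k
mexSearch (suc f) k l = if elemℕ k l then mexSearch f (suc k) l else k

mex : List ℕ → ℕ
mex l = mexSearch (len l) 0 l

grundy : Game → ℕ
grundyL : List Game → List ℕ
grundy (mk gs) = mex (grundyL gs)
grundyL [] = []
grundyL (g ∷ gs) = grundy g ∷ grundyL gs

GameSet : Set₁
GameSet = Game → Set

record Closed (A : GameSet) : Set where
  field
    has-zero : A zeroG
    opt-closed : ∀ {X Y} → A X → Y ∈ options X → A Y
    sum-closed : ∀ {X Y} → A X → A Y → A (X ⊕ Y)

data Cl (A : GameSet) (G : Game) : Game → Set where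
  base : ∀ {X} → A X → Cl A G X
  gen  : Cl A G G
  zro  : Cl A G zeroG
  opt  : ∀ {X Y} → Cl A G X → Y ∈ options X → Cl A G Y
  sm   : ∀ {X Y} → Cl A G X → Cl A G Y → Cl A G (X ⊕ Y)

Indist : GameSet → Game → Game → Set
Indist A G H = ∀ X → A X → isP (G ⊕ X) ≡ isP (H ⊕ X)

-- The monoid T_n. Indices i ∈ {0,…,2^n-1} are represented as n-bit
-- vectors (least significant bit first); ⊕ on indices is bitwise XOR.

bitsVal : ∀ {n} → Vec Bool n → ℕ
bitsVal [] = 0
bitsVal (b ∷ bs) = (if b then 1 else 0) + 2 * bitsVal bs

xorBits : ∀ {n} → Vec Bool n → Vec Bool n → Vec Bool n
xorBits = zipWith _xor_

flip1 : ∀ {n} → Vec Bool n → Vec Bool n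
flip1 [] = []
flip1 (b ∷ bs) = not b ∷ bs

data T (n : ℕ) : Set where
  one : T n
  a   : T n
  z   : Vec Bool n → T n

infixl 7 _·_
_·_ : ∀ {n} → T n → T n → T n
one · t = t
a · one = a
a · a = one
a · z v = z (flip1 v)
z u · one = z u
z u · a = z (flip1 u)
z u · z v = z (xorBits u v)

z₀ : ∀ {n} → T n
z₀ {n} = z (replicate n false)

Dist : ∀ {n} → T n → Set
Dist t = (t ≡ a) ⊎ (t ≡ z₀)

Restless : ∀ {n} → (T n → Set) → Set
Restless E =
  (E a × E z₀ × ¬ E one × ¬ E (a · z₀)) ⊎
  (E one × E (a · z₀) × ¬ E a × ¬ E z₀)

-- "Q(A) is identified with T_n": φ : A → T_n induces an isomorphism of
-- monoids with distinguished subsets A/≡_A ≅ T_n.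

record Identification (n : ℕ) (A : GameSet) (φ : Game → T n) : Set where
  field
    surj    : ∀ t → ∃ λ X → A X × φ X ≡ t
    kernel  : ∀ {X Y} → A X → A Y → (φ X ≡ φ Y → Indist A X Y) × (Indist A X Y → φ X ≡ φ Y)
    hom     : ∀ {X Y} → A X → A Y → φ (X ⊕ Y) ≡ φ X · φ Y
    dist    : ∀ {X} → A X → (isP X ≡ true → Dist (φ X)) × (Dist (φ X) → isP X ≡ true)

Image : ∀ {n} → (Game → T n) → Game → T n → Set
Image φ G t = ∃ λ G' → G' ∈ options G × φ G' ≡ t

AtLeast3PClasses : GameSet → Set
AtLeast3PClasses B =
  Σ Game λ X → Σ Game λ Y → Σ Game λ W →
    B X × B Y × B W ×
    isP X ≡ true × isP Y ≡ true × isP W ≡ true ×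
    ¬ Indist B X Y × ¬ Indist B X W × ¬ Indist B Y W

-- Let Sₐ, S₀ ∈ A have classes a and z₀; they are inequivalent P-positions.
-- A third one is any P-position W of cl(A ∪ {G}) having options in A of
-- classes 1 and az₀. If Φ''G ∩ {1,a,z,az} = {1,az}, no option of G is a
-- P-position, so W = G works. If it is {a,z}, take W = G + S with S ∈ A a
-- game all of whose options are 0 (found below any nonzero game of A): S has
-- non-zero Grundy value, so its class is a, and then every option of W is an
-- N-position.
module Submission where

open import Defs
open import Data.Nat using (ℕ; _≤_; zero; suc; s≤s)
open import Data.Bool using (Bool; true; false)
open import Data.Vec using (Vec)
import Data.Vec as Vec
open import Data.List using ([]; _∷_; map; replicate; length)
open import Data.List.Properties using (++-identityʳ)
open import Data.List.Membership.Propositional using (_∈_)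
open import Data.List.Membership.Propositional.Properties using (∈-++⁺ˡ; ∈-++⁻; ∈-map⁺; ∈-map⁻)
open import Data.List.Relation.Unary.Any using (here; there)
open import Data.List.Relation.Unary.All using (All; []; _∷_)
import Data.List.Relation.Unary.All as All
open import Data.List.Relation.Unary.All.Properties using (replicate⁺)
open import Data.Product using (_×_; ∃; _,_; proj₁; proj₂)
open import Data.Sum using (_⊎_; inj₁; inj₂; [_,_])
import Data.Sum as Sum
open import Data.Empty using (⊥-elim)
open import Relation.Nullary using (¬_)
open import Relation.Binary.PropositionalEquality
  using (_≡_; _≢_; refl; sym; trans; cong; cong₂; subst; ≢-sym; module ≡-Reasoning)

sumL≡map : ∀ xs h → sumL xs h ≡ map (_⊕ h) xs
sumL≡map []       h = refl
sumL≡map (x ∷ xs) h = cong (x ⊕ h ∷_) (sumL≡map xs h)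

sumR≡map : ∀ g hs → sumR g hs ≡ map (g ⊕_) hs
sumR≡map g []       = refl
sumR≡map g (h ∷ hs) = cong (g ⊕ h ∷_) (sumR≡map g hs)

option-⊕ˡ : ∀ X Y {X'} → X' ∈ options X → X' ⊕ Y ∈ options (X ⊕ Y)
option-⊕ˡ (mk xs) (mk ys) m = ∈-++⁺ˡ (subst (_ ∈_) (sym (sumL≡map xs (mk ys))) (∈-map⁺ (_⊕ mk ys) m))

options-⊕⁻ : ∀ X Y {W} → W ∈ options (X ⊕ Y) →
             (∃ λ X' → X' ∈ options X × W ≡ X' ⊕ Y) ⊎ (∃ λ Y' → Y' ∈ options Y × W ≡ X ⊕ Y')
options-⊕⁻ (mk xs) (mk ys) m with ∈-++⁻ (sumL xs (mk ys)) m
... | inj₁ m = inj₁ (∈-map⁻ (_⊕ mk ys) (subst (_ ∈_) (sumL≡map xs (mk ys)) m))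
... | inj₂ m = inj₂ (∈-map⁻ (mk xs ⊕_) (subst (_ ∈_) (sumR≡map (mk xs) ys) m))

⊕-identityʳ : ∀ X → X ⊕ zeroG ≡ X
sumL-identityʳ : ∀ xs → sumL xs zeroG ≡ xs
⊕-identityʳ (mk xs) = cong mk (trans (++-identityʳ _) (sumL-identityʳ xs))
sumL-identityʳ []       = refl
sumL-identityʳ (x ∷ xs) = cong₂ _∷_ (⊕-identityʳ x) (sumL-identityʳ xs)

allN-true : ∀ {l} → All (λ x → isP x ≡ false) l → allN l ≡ true
allN-true []           = refl
allN-true (nx ∷ nxs) rewrite nx = allN-true nxs

allN-false : ∀ {x} l → x ∈ l → isP x ≡ true → allN l ≡ false
allN-false (y ∷ l) (here refl) p rewrite p = refl
allN-false (y ∷ l) (there m)   p rewrite allN-false l m p with isP y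
... | true  = refl
... | false = refl

isP-intro : ∀ X → X ≢ zeroG → (∀ {Y} → Y ∈ options X → isP Y ≡ false) → isP X ≡ true
isP-intro (mk [])      X≢0 _   = ⊥-elim (X≢0 refl)
isP-intro (mk (y ∷ l)) _   nys = allN-true (All.tabulate nys)

isN-of-P-option : ∀ X {Y} → Y ∈ options X → isP Y ≡ true → isP X ≡ false
isN-of-P-option (mk (y ∷ l)) = allN-false (y ∷ l)

distinguished : ∀ {B : GameSet} X Y {Z} → B Z → isP (X ⊕ Z) ≢ isP (Y ⊕ Z) → ¬ Indist B X Y
distinguished _ _ bZ ne X≈Y = ne (X≈Y _ bZ)

P≢N : ∀ {b c} → b ≡ true → c ≡ false → b ≢ c
P≢N refl refl ()

stars : ℕ → Game
stars k = mk (replicate (suc k) zeroG)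

option-stars : ∀ {k Y} → Y ∈ options (stars k) → Y ≡ zeroG
option-stars {k} = All.lookup (replicate⁺ {P = _≡ zeroG} (suc k) refl)

isP-stars : ∀ k → isP (stars k) ≡ true
isP-stars k = isP-intro (stars k) (λ ()) (λ m → cong isP (option-stars m))

mexSearch-suc≢0 : ∀ f k l → mexSearch f (suc k) l ≢ 0
mexSearch-suc≢0 zero    k l ()
mexSearch-suc≢0 (suc f) k l with elemℕ (suc k) l
... | true  = mexSearch-suc≢0 f (suc k) l
... | false = λ ()

grundy-stars≢0 : ∀ k → grundy (stars k) ≢ 0
grundy-stars≢0 k = mexSearch-suc≢0 (len l) 0 (0 ∷ l)
  where l = grundyL (replicate k zeroG)

module _ (P : GameSet) (opt-closed : ∀ {X Y} → P X → Y ∈ options X → P Y) where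

  stars-below : ∀ X → P X → X ≢ zeroG → ∃ λ k → P (stars k)
  stars-among : ∀ l → (∀ {x} → x ∈ l → P x) →
                (∃ λ k → P (stars k)) ⊎ l ≡ replicate (length l) zeroG

  stars-below (mk [])       _  X≢0 = ⊥-elim (X≢0 refl)
  stars-below (mk (x ∷ xs)) pX _   with stars-among (x ∷ xs) (opt-closed pX)
  ... | inj₁ found = found
  ... | inj₂ eq    = length xs , subst P (cong mk eq) pX

  stars-among []              _   = inj₂ refl
  stars-among (mk [] ∷ l)     pl with stars-among l (λ m → pl (there m))
  ... | inj₁ found = inj₁ found
  ... | inj₂ eq    = inj₂ (cong (zeroG ∷_) eq)
  stars-among (mk (y ∷ ys) ∷ l) pl = inj₁ (stars-below (mk (y ∷ ys)) (pl (here refl)) (λ ()))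

flip1-involutive : ∀ {n} (v : Vec Bool n) → flip1 (flip1 v) ≡ v
flip1-involutive Vec.[]          = refl
flip1-involutive (true Vec.∷ v)  = refl
flip1-involutive (false Vec.∷ v) = refl

a·-involutive : ∀ {n} (t : T n) → a · (a · t) ≡ t
a·-involutive one = refl
a·-involutive a   = refl
a·-involutive (z v) = cong z (flip1-involutive v)

·a≡a· : ∀ {n} (t : T n) → t · a ≡ a · t
·a≡a· one   = refl
·a≡a· a     = refl
·a≡a· (z v) = refl

xorBits-self : ∀ {n} (v : Vec Bool n) → xorBits v v ≡ Vec.replicate n false
xorBits-self Vec.[]          = refl
xorBits-self (true Vec.∷ v)  = cong (false Vec.∷_) (xorBits-self v)
xorBits-self (false Vec.∷ v) = cong (false Vec.∷_) (xorBits-self v)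

z-square : ∀ {n} (v : Vec Bool n) → z v · z v ≡ z₀
z-square v = cong z (xorBits-self v)

a·z₀-square : ∀ {n} → (a · z₀ {n}) · (a · z₀) ≡ z₀
a·z₀-square {n} = z-square (flip1 (Vec.replicate n false))

¬Dist-a·z₀ : ∀ {n} → ¬ Dist (a · z₀ {suc n})
¬Dist-a·z₀ (inj₁ ())
¬Dist-a·z₀ (inj₂ ())

Dist-·a : ∀ {n} (t : T n) → Dist (t · a) → t ≡ one ⊎ t ≡ a · z₀
Dist-·a t d = Sum.map (cancel t) (cancel t) d
  where
  cancel : ∀ t {s} → t · a ≡ s → t ≡ a · s
  cancel t {s} eq = begin
    t             ≡⟨ sym (a·-involutive t) ⟩
    a · (a · t)   ≡⟨ cong (a ·_) (sym (·a≡a· t)) ⟩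
    a · (t · a)   ≡⟨ cong (a ·_) eq ⟩
    a · s         ∎
    where open ≡-Reasoning

bitsVal-zeros : ∀ n → bitsVal (Vec.replicate n false) ≡ 0
bitsVal-zeros zero    = refl
bitsVal-zeros (suc n) rewrite bitsVal-zeros n = refl

option⇒≢zeroG : ∀ {X Y} → Y ∈ options X → X ≢ zeroG
option⇒≢zeroG () refl

isP⇒≢zeroG : ∀ {X} → isP X ≡ true → X ≢ zeroG
isP⇒≢zeroG () refl

module Identified (n : ℕ) (A : GameSet) (closed : Closed A) (φ : Game → T (suc n))
                  (ident : Identification (suc n) A φ) where

  open Closed closed
  open Identification ident

  GrundyIndexed : Set
  GrundyIndexed = ∀ {X} {i : Vec Bool (suc n)} → A X → φ X ≡ z i → grundy X ≡ bitsVal i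

  record OptionOfClass (W : Game) (t : T (suc n)) : Set where
    constructor option
    field
      {game}   : Game
      ∈options : game ∈ options W
      ∈A       : A game
      class    : φ game ≡ t

  isP-of-class : ∀ {X} → A X → Dist (φ X) → isP X ≡ true
  isP-of-class aX = proj₂ (dist aX)

  isN-of-class : ∀ {X} → A X → ¬ Dist (φ X) → isP X ≡ false
  isN-of-class {X} aX ¬d with isP X in eq
  ... | true  = ⊥-elim (¬d (proj₁ (dist aX) eq))
  ... | false = refl

  φ-⊕ : ∀ {X Y s t} → A X → A Y → φ X ≡ s → φ Y ≡ t → φ (X ⊕ Y) ≡ s · t
  φ-⊕ aX aY refl refl = hom aX aY

  option-of-image : ∀ {G t} → (∀ {G'} → G' ∈ options G → A G') → Image φ G t → OptionOfClass G t
  option-of-image optA (G' , m , e) = option m (optA m) e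

  option-⊕-of-class : ∀ {X Y s t} → OptionOfClass X s → A Y → φ Y ≡ t → OptionOfClass (X ⊕ Y) (s · t)
  option-⊕-of-class {X} {Y} (option m aX' e) aY eY =
    option (option-⊕ˡ X Y m) (sum-closed aX' aY) (φ-⊕ aX' aY e eY)

  isN-by-option-of-inverse-class : ∀ {W Y s t} → OptionOfClass W s → A Y → φ Y ≡ t → s · t ≡ z₀ →
                                   isP (W ⊕ Y) ≡ false
  isN-by-option-of-inverse-class {W} {Y} (option m aW' e) aY eY st≡z₀ =
    isN-of-P-option (W ⊕ Y) (option-⊕ˡ W Y m)
      (isP-of-class (sum-closed aW' aY) (inj₂ (trans (φ-⊕ aW' aY e eY) st≡z₀)))

  -- W is told apart from a by a game of class az₀ and from z₀ by one of class
  -- z₀: added to W, each creates an option of class z₀, hence a P-option.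
  three-P-classes : ∀ {B W} → (∀ {X} → A X → B X) → B W → isP W ≡ true →
                    OptionOfClass W one → OptionOfClass W (a · z₀) → AtLeast3PClasses B
  three-P-classes {W = W} A⊆B bW pW W₁ Wₐ₀ with surj a | surj z₀ | surj (a · z₀)
  ... | Sₐ , aSₐ , eSₐ | S₀ , aS₀ , eS₀ | Sₐ₀ , aSₐ₀ , eSₐ₀ =
    Sₐ , S₀ , W , A⊆B aSₐ , A⊆B aS₀ , bW , isP-of-class aSₐ (inj₁ eSₐ) , pS₀ , pW ,
    distinguished Sₐ S₀ (A⊆B aS₀) (≢-sym (P≢N pS₀S₀ nSₐS₀)) ,
    distinguished Sₐ W (A⊆B aSₐ₀) (P≢N pSₐSₐ₀ (isN-by-option-of-inverse-class Wₐ₀ aSₐ₀ eSₐ₀ a·z₀-square)) ,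
    distinguished S₀ W (A⊆B aS₀) (P≢N pS₀S₀ (isN-by-option-of-inverse-class W₁ aS₀ eS₀ refl))
    where
    pS₀ : isP S₀ ≡ true
    pS₀ = isP-of-class aS₀ (inj₂ eS₀)
    pS₀S₀ : isP (S₀ ⊕ S₀) ≡ true
    pS₀S₀ = isP-of-class (sum-closed aS₀ aS₀)
      (inj₂ (trans (φ-⊕ aS₀ aS₀ eS₀ eS₀) (z-square (Vec.replicate (suc n) false))))
    nSₐS₀ : isP (Sₐ ⊕ S₀) ≡ false
    nSₐS₀ = isN-of-class (sum-closed aSₐ aS₀) (λ d → ¬Dist-a·z₀ (subst Dist (φ-⊕ aSₐ aS₀ eSₐ eS₀) d))
    pSₐSₐ₀ : isP (Sₐ ⊕ Sₐ₀) ≡ true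
    pSₐSₐ₀ = isP-of-class (sum-closed aSₐ aSₐ₀) (inj₂ (φ-⊕ aSₐ aSₐ₀ eSₐ eSₐ₀))

  -- Since 0 is an option, grundy (stars k) ≠ 0 = bitsVal of the index of z₀.
  stars-of-class-a : GrundyIndexed → ∃ λ k → A (stars k) × φ (stars k) ≡ a
  stars-of-class-a grundy-indexed with surj z₀
  ... | S₀ , aS₀ , eS₀ with stars-below A opt-closed S₀ aS₀ (isP⇒≢zeroG (isP-of-class aS₀ (inj₂ eS₀)))
  ... | k , aS with proj₁ (dist aS) (isP-stars k)
  ... | inj₁ e = k , aS , e
  ... | inj₂ e = ⊥-elim (grundy-stars≢0 k (trans (grundy-indexed aS e) (bitsVal-zeros (suc n))))

  isP-without-options-in-Dist : ∀ {G} → G ≢ zeroG → (∀ {G'} → G' ∈ options G → A G') →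
                                ¬ Image φ G a → ¬ Image φ G z₀ → isP G ≡ true
  isP-without-options-in-Dist {G} G≢0 optA ¬Iₐ ¬I₀ = isP-intro G G≢0 λ {G'} m →
    isN-of-class (optA m) λ { (inj₁ e) → ¬Iₐ (G' , m , e) ; (inj₂ e) → ¬I₀ (G' , m , e) }

  -- Options G' + S are N since φ G' ∉ {1, az₀}; the options G + 0 = G are N
  -- since G has an option of class a.
  isP-⊕-stars : ∀ G {k} → (∀ {G'} → G' ∈ options G → A G') → A (stars k) → φ (stars k) ≡ a →
                Image φ G a → ¬ Image φ G one → ¬ Image φ G (a · z₀) → isP (G ⊕ stars k) ≡ true
  isP-⊕-stars G {k} optA aS eS (Gₐ , mGₐ , eGₐ) ¬I₁ ¬Iₐ₀ =
    isP-intro (G ⊕ stars k) (option⇒≢zeroG (option-⊕ˡ G (stars k) mGₐ)) option-isN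
    where
    option-isN : ∀ {Y} → Y ∈ options (G ⊕ stars k) → isP Y ≡ false
    option-isN m with options-⊕⁻ G (stars k) m
    ... | inj₁ (G' , m' , refl) = isN-of-class (sum-closed (optA m') aS) λ d →
      [ (λ e → ¬I₁ (G' , m' , e)) , (λ e → ¬Iₐ₀ (G' , m' , e)) ]
        (Dist-·a (φ G') (subst Dist (φ-⊕ (optA m') aS refl eS) d))
    ... | inj₂ (Y , m' , refl) rewrite option-stars m' | ⊕-identityʳ G =
      isN-of-P-option G mGₐ (isP-of-class (optA mGₐ) (inj₁ eGₐ))

  restless⇒three-P-classes : GrundyIndexed → ∀ G → G ≢ zeroG → (∀ {G'} → G' ∈ options G → A G') →
                             Restless (Image φ G) → AtLeast3PClasses (Cl A G)
  restless⇒three-P-classes grundy-indexed G G≢0 optA (inj₁ (Iₐ , I₀ , ¬I₁ , ¬Iₐ₀))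
    with stars-of-class-a grundy-indexed
  ... | k , aS , eS = three-P-classes base (sm gen (base aS)) (isP-⊕-stars G optA aS eS Iₐ ¬I₁ ¬Iₐ₀)
    (option-⊕-of-class (option-of-image optA Iₐ) aS eS)
    (option-⊕-of-class (option-of-image optA I₀) aS eS)
  restless⇒three-P-classes _ _ G≢0 optA (inj₂ (I₁ , Iₐ₀ , ¬Iₐ , ¬I₀)) =
    three-P-classes base gen (isP-without-options-in-Dist G≢0 optA ¬Iₐ ¬I₀)
      (option-of-image optA I₁) (option-of-image optA Iₐ₀)

-- Faithfulness is not needed: the Grundy values of the classes z i suffice,
-- and n ≥ 1 is enough.
lemma4p8 : (n : ℕ) → 2 ≤ n →
    (A : GameSet) → Closed A →
    (φ : Game → T n) → Identification n A φ →
    (∀ {X Y} → A X → A Y → φ X ≡ φ Y → grundy X ≡ grundy Y) →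
    (∀ {X} {i : Vec Bool n} → A X → φ X ≡ z i → grundy X ≡ bitsVal i) →
    (G : Game) → G ≢ zeroG → (∀ {G'} → G' ∈ options G → A G') →
    Restless (Image φ G) →
    AtLeast3PClasses (Cl A G)
lemma4p8 (suc n) (s≤s _) A closed φ ident _ grundy-indexed G G≢0 optA =
  Identified.restless⇒three-P-classes n A closed φ ident grundy-indexed G G≢0 optA
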